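{- If $d, l_0 \in \mathbb{Z}_{\ge 0}$ and $l_1, \dotsc, l_d \in \mathbb{Z}_{\ge 1}$, then $s(A(l_0, l_1, \dotsc, l_d)) = K(l_1, \dotsc, l_d)$.
   Context: The Stern sequence $(s(n))_{n\ge 0}$ is defined by $s(0)=0$, $s(1)=1$, $s(2n)=s(n)$ and $s(2n+1)=s(n)+s(n+1)$ for all $n\ge 0$. For $d, l_0 \in \mathbb{Z}_{\ge 0}$ and $l_1,\dotsc,l_d \in \mathbb{Z}_{\ge 1}$, $A(l_0, \dotsc, l_d) = \sum_{i=0}^d (-1)^{d-i} 2^{l_0+\dotsb+l_i}$. The continuants $K_d(X_1,\dotsc,X_d)\in\mathbb{Z}[X_1,\dotsc,X_d]$ are defined by $K_0 = 1$, $K_1(X_1) = X_1$, and $K_d(X_1,\dotsc,X_d) = X_d K_{d-1}(X_1,\dotsc,X_{d-1}) + K_{d-2}(X_1,\dotsc,X_{d-2})$ for $d\ge 2$; one writes $K(X_1,\dotsc,X_d)$ for $K_d(X_1,\dotsc,X_d)$ (so $K()=1$). -}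

module Defs where

open import Data.Nat using (ℕ; zero; suc; _+_; _*_; _^_)
open import Data.Nat.Properties using (_≟_)
open import Data.Nat.Base using (⌊_/2⌋)
open import Data.Integer as ℤ using (ℤ; +_)
open import Data.List using (List; []; _∷_)
open import Data.Product using (_×_; _,_; proj₁; proj₂)
open import Data.Bool using (if_then_else_)
open import Relation.Nullary.Decidable using (⌊_⌋)

-- Stern sequence, computed with fuel (fuel n+1 suffices for argument n,
-- since every recursive call is on an argument ≤ the current one / 2 + 1
-- and strictly smaller for n ≥ 2).
sFuel : ℕ → ℕ → ℕ
sFuel zero    _ = 0
sFuel (suc f) zero = 0
sFuel (suc f) (suc zero) = 1
sFuel (suc f) (suc (suc m)) with Data.Nat.Base._%_ (suc (suc m)) 2
... | zero  = sFuel f ⌊ suc (suc m) /2⌋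
... | suc _ = sFuel f ⌊ suc (suc m) /2⌋ + sFuel f (suc ⌊ suc (suc m) /2⌋)

s : ℕ → ℕ
s n = sFuel (suc n) n

-- Continuants: K() = 1, K(X1) = X1, K(X1..Xd) = Xd K(X1..X(d-1)) + K(X1..X(d-2)).
-- Helper: given (K_{k-1}, K_k) for a prefix, process remaining entries left to right.
Kstep : ℕ × ℕ → List ℕ → ℕ × ℕ
Kstep (a , b) []       = (a , b)
Kstep (a , b) (x ∷ xs) = Kstep (b , x * b + a) xs

-- K_{-1} = 0, K_0 = 1, so K_1 = X1 * 1 + 0 = X1.
K : List ℕ → ℕ
K xs = proj₂ (Kstep (0 , 1) xs)

-- A(l0, l1, ..., ld) = Σ_{i=0}^{d} (-1)^{d-i} 2^{l0+...+li}, as an integer.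
-- Aacc p σ ls : p = partial sum of l's so far (l0+...+l_{i}), accumulated
-- result σ over indices 0..i with sign (-1)^{i-j}; processing l_{i+1} negates.
Aacc : ℕ → ℤ → List ℕ → ℤ
Aacc p σ []       = σ
Aacc p σ (l ∷ ls) = Aacc (p + l) (+ (2 ^ (p + l)) ℤ.- σ) ls

A : ℕ → List ℕ → ℤ
A l0 ls = Aacc l0 (+ (2 ^ l0)) ls

{-# OPTIONS --safe #-}
-- Let b = A(0, l₁, …, l_d) and let c be the same alternating sum without
-- its i = 0 term (−1)^d, so that A(l₀, l₁, …, l_d) = 2^l₀ b and b, c are
-- adjacent naturals.  Prepending l to (l₁, …, l_d) sends (b, c) to
-- (2^l b − b + c, 2^l b), and the Stern identities
-- s(2^l m ± 1) = l s(m) + s(m ± 1) show that (s b, s c) then evolves like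
-- (K(l, l₁, …), K(l₁, …)) under the first-entry expansion
-- K(l, l₁, l₂, …) = l K(l₁, l₂, …) + K(l₂, …).
module Submission where

open import Defs
open import Data.Nat using (ℕ; _≤_)
open import Data.Integer using (+_; ∣_∣)
open import Data.List using (List)
open import Data.List.Relation.Unary.All using (All)
open import Data.Product using (_×_)
open import Relation.Binary.PropositionalEquality using (_≡_)

open import Data.Nat using (zero; suc; pred; _+_; _*_; _^_; _<_; _%_; ⌊_/2⌋; s≤s; NonZero)
open import Data.Nat.Properties
  using (+-suc; +-assoc; +-identityʳ; *-suc; *-assoc; m≤m+n; n≤1+n; ≤-refl; ≤-trans;
         ^-distribˡ-+-*; n≡⌊n+n/2⌋; suc-pred; m*n≢0; m^n≢0)
open import Data.Integer as ℤ using (ℤ; 0ℤ; 1ℤ)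
open import Data.Integer.Properties using (pos-+; pos-*)
open import Data.List using ([]; _∷_)
open import Data.Product using (_,_; proj₂)
open import Relation.Binary.PropositionalEquality using (refl; sym; trans; cong; cong₂; subst; module ≡-Reasoning)
import Data.Nat.Tactic.RingSolver as ℕ-Ring
import Data.Integer.Tactic.RingSolver as ℤ-Ring

open ≡-Reasoning

data EvenOrOdd : ℕ → Set where
  even : ∀ k → EvenOrOdd (k + k)
  odd  : ∀ k → EvenOrOdd (suc (k + k))

evenOrOdd : ∀ n → EvenOrOdd n
evenOrOdd zero = even 0
evenOrOdd (suc n) with evenOrOdd n
... | even k = odd k
... | odd k rewrite sym (+-suc k k) = even (suc k)

[k+k]%2≡0 : ∀ k → (k + k) % 2 ≡ 0
[k+k]%2≡0 zero = refl
[k+k]%2≡0 (suc k) rewrite +-suc k k = [k+k]%2≡0 k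

[1+k+k]%2≡1 : ∀ k → suc (k + k) % 2 ≡ 1
[1+k+k]%2≡1 zero = refl
[1+k+k]%2≡1 (suc k) rewrite +-suc k k = [1+k+k]%2≡1 k

⌊1+k+k/2⌋≡k : ∀ k → ⌊ suc (k + k) /2⌋ ≡ k
⌊1+k+k/2⌋≡k zero = refl
⌊1+k+k/2⌋≡k (suc k) rewrite +-suc k k = cong suc (⌊1+k+k/2⌋≡k k)

sFuel-even : ∀ f k → sFuel (suc f) (2 + (k + k)) ≡ sFuel f (suc k)
sFuel-even f k rewrite [k+k]%2≡0 k | sym (n≡⌊n+n/2⌋ k) = refl

sFuel-odd : ∀ f k → sFuel (suc f) (3 + (k + k)) ≡ sFuel f (suc k) + sFuel f (2 + k)
sFuel-odd f k rewrite [1+k+k]%2≡1 k | ⌊1+k+k/2⌋≡k k = refl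

sFuel-stable : ∀ {f g} n → n < f → n < g → sFuel f n ≡ sFuel g n
sFuel-stable {suc f} {suc g} zero _ _ = refl
sFuel-stable {suc f} {suc g} (suc zero) _ _ = refl
sFuel-stable {suc f} {suc g} (suc (suc m)) (s≤s p) (s≤s q) with evenOrOdd m
... | even k = begin
  sFuel (suc f) (2 + (k + k)) ≡⟨ sFuel-even f k ⟩
  sFuel f (suc k)             ≡⟨ sFuel-stable (suc k) (half<f p) (half<f q) ⟩
  sFuel g (suc k)             ≡⟨ sym (sFuel-even g k) ⟩
  sFuel (suc g) (2 + (k + k)) ∎
  where
  half<f : ∀ {h} → 2 + (k + k) ≤ h → suc k < h
  half<f = ≤-trans (s≤s (s≤s (m≤m+n k k)))
... | odd k = begin
  sFuel (suc f) (3 + (k + k))            ≡⟨ sFuel-odd f k ⟩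
  sFuel f (suc k) + sFuel f (2 + k)      ≡⟨ cong₂ _+_ (sFuel-stable (suc k) (half<f p) (half<f q))
                                                       (sFuel-stable (2 + k) (1+half<f p) (1+half<f q)) ⟩
  sFuel g (suc k) + sFuel g (2 + k)      ≡⟨ sym (sFuel-odd g k) ⟩
  sFuel (suc g) (3 + (k + k))            ∎
  where
  1+half<f : ∀ {h} → 3 + (k + k) ≤ h → 2 + k < h
  1+half<f = ≤-trans (s≤s (s≤s (s≤s (m≤m+n k k))))
  half<f : ∀ {h} → 3 + (k + k) ≤ h → suc k < h
  half<f r = ≤-trans (n≤1+n _) (1+half<f r)

2*suc : ∀ k → 2 * suc k ≡ 2 + (k + k)
2*suc k = trans (*-suc 2 k) (cong (λ x → 2 + (k + x)) (+-identityʳ k))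

s-double : ∀ n → s (2 * n) ≡ s n
s-double zero = refl
s-double (suc k) = begin
  s (2 * suc k)              ≡⟨ cong s (2*suc k) ⟩
  s (2 + (k + k))            ≡⟨ sFuel-even _ k ⟩
  sFuel (2 + (k + k)) (suc k) ≡⟨ sFuel-stable (suc k) (s≤s (s≤s (m≤m+n k k))) ≤-refl ⟩
  s (suc k)                  ∎

s-double-suc : ∀ n → s (suc (2 * n)) ≡ s n + s (suc n)
s-double-suc zero = refl
s-double-suc (suc k) = begin
  s (suc (2 * suc k))                                       ≡⟨ cong (λ x → s (suc x)) (2*suc k) ⟩
  s (3 + (k + k))                                           ≡⟨ sFuel-odd _ k ⟩
  sFuel (3 + (k + k)) (suc k) + sFuel (3 + (k + k)) (2 + k) ≡⟨ cong₂ _+_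
      (sFuel-stable (suc k) (s≤s (s≤s (≤-trans (m≤m+n k k) (n≤1+n _)))) ≤-refl)
      (sFuel-stable (2 + k) (s≤s (s≤s (s≤s (m≤m+n k k)))) ≤-refl) ⟩
  s (suc k) + s (2 + k)                                     ∎

s-2^* : ∀ k m → s (2 ^ k * m) ≡ s m
s-2^* zero m = cong s (+-identityʳ m)
s-2^* (suc k) m = begin
  s (2 * 2 ^ k * m)   ≡⟨ cong s (*-assoc 2 (2 ^ k) m) ⟩
  s (2 * (2 ^ k * m)) ≡⟨ s-double (2 ^ k * m) ⟩
  s (2 ^ k * m)       ≡⟨ s-2^* k m ⟩
  s m                 ∎

s-suc-2^* : ∀ k m → s (suc (2 ^ k * m)) ≡ k * s m + s (suc m)
s-suc-2^* zero m = cong (λ x → s (suc x)) (+-identityʳ m)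
s-suc-2^* (suc k) m = begin
  s (suc (2 * 2 ^ k * m))                 ≡⟨ cong (λ x → s (suc x)) (*-assoc 2 (2 ^ k) m) ⟩
  s (suc (2 * (2 ^ k * m)))               ≡⟨ s-double-suc (2 ^ k * m) ⟩
  s (2 ^ k * m) + s (suc (2 ^ k * m))     ≡⟨ cong₂ _+_ (s-2^* k m) (s-suc-2^* k m) ⟩
  s m + (k * s m + s (suc m))             ≡⟨ sym (+-assoc (s m) (k * s m) _) ⟩
  suc k * s m + s (suc m)                 ∎

2^*suc≢0 : ∀ k m → NonZero (2 ^ k * suc m)
2^*suc≢0 k m = m*n≢0 (2 ^ k) (suc m) {{m^n≢0 2 k}}

pred-2* : ∀ x .{{_ : NonZero x}} → pred (2 * x) ≡ suc (2 * pred x)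
pred-2* (suc y) = +-suc y (y + 0)

s-pred-2^*suc : ∀ k m → s (pred (2 ^ k * suc m)) ≡ k * s (suc m) + s m
s-pred-2^*suc zero m = cong s (+-identityʳ m)
s-pred-2^*suc (suc k) m = begin
  s (pred (2 * 2 ^ k * suc m))           ≡⟨ cong (λ y → s (pred y)) (*-assoc 2 (2 ^ k) (suc m)) ⟩
  s (pred (2 * x))                       ≡⟨ cong s (pred-2* x) ⟩
  s (suc (2 * pred x))                   ≡⟨ s-double-suc (pred x) ⟩
  s (pred x) + s (suc (pred x))          ≡⟨ cong₂ _+_ (s-pred-2^*suc k m) (cong s (suc-pred x)) ⟩
  (k * s (suc m) + s m) + s x            ≡⟨ cong (λ y → (k * s (suc m) + s m) + y) (s-2^* k (suc m)) ⟩
  (k * s (suc m) + s m) + s (suc m)      ≡⟨ regroup k (s (suc m)) (s m) ⟩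
  suc k * s (suc m) + s m                ∎
  where
  regroup : ∀ k a b → (k * a + b) + a ≡ suc k * a + b
  regroup = ℕ-Ring.solve-∀
  x = 2 ^ k * suc m
  instance _ = 2^*suc≢0 k m

data Adjacent : ℕ → ℕ → Set where
  down : ∀ n → Adjacent (suc n) n
  up   : ∀ n → Adjacent n (suc n)

next : ℕ → ∀ {b c} → Adjacent b c → ℕ
next l (down n) = pred (2 ^ l * suc n)
next l (up n)   = suc (2 ^ l * n)

next-+ : ∀ l {b c} (adj : Adjacent b c) → next l adj + b ≡ 2 ^ l * b + c
next-+ l (down n) = trans (+-suc _ n) (cong (_+ n) (suc-pred (2 ^ l * suc n)))
  where instance _ = 2^*suc≢0 l n
next-+ l (up n) = sym (+-suc (2 ^ l * n) n)

next-adjacent : ∀ l {b c} (adj : Adjacent b c) → Adjacent (next l adj) (2 ^ l * b)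
next-adjacent l (down n) = subst (Adjacent _) (suc-pred (2 ^ l * suc n)) (up _)
  where instance _ = 2^*suc≢0 l n
next-adjacent l (up n) = down _

s-next : ∀ l {b c} (adj : Adjacent b c) → s (next l adj) ≡ l * s b + s c
s-next l (down n) = s-pred-2^*suc l n
s-next l (up n)   = s-suc-2^* l n

-- K⁻ (x ∷ xs) is the continuant K xs of the tail, and K⁻ [] plays K₋₁ = 0.
K⁻ : List ℕ → ℕ
K⁻ []       = 0
K⁻ (_ ∷ xs) = K xs

Kstep-linear : ∀ xs a b → proj₂ (Kstep (a , b) xs) ≡ a * K⁻ xs + b * K xs
Kstep-linear [] a b = base a b
  where
  base : ∀ a b → b ≡ a * 0 + b * 1
  base = ℕ-Ring.solve-∀
Kstep-linear (x ∷ xs) a b = begin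
  proj₂ (Kstep (b , x * b + a) xs)                  ≡⟨ Kstep-linear xs b (x * b + a) ⟩
  b * K⁻ xs + (x * b + a) * K xs                    ≡⟨ regroup a b x (K⁻ xs) (K xs) ⟩
  a * K xs + b * (1 * K⁻ xs + (x * 1 + 0) * K xs)   ≡⟨ cong (λ k → a * K xs + b * k) (sym (Kstep-linear xs 1 (x * 1 + 0))) ⟩
  a * K xs + b * K (x ∷ xs)                         ∎
  where
  regroup : ∀ a b x m k → b * m + (x * b + a) * k ≡ a * k + b * (1 * m + (x * 1 + 0) * k)
  regroup = ℕ-Ring.solve-∀

K-cons : ∀ x xs → K (x ∷ xs) ≡ x * K xs + K⁻ xs
K-cons x xs = trans (Kstep-linear xs 1 (x * 1 + 0)) (regroup x (K⁻ xs) (K xs))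
  where
  regroup : ∀ x m k → 1 * m + (x * 1 + 0) * k ≡ x * k + m
  regroup = ℕ-Ring.solve-∀

-- A′ ls is A 0 ls without its i = 0 term (−1)^d.
A′ : List ℕ → ℤ
A′ = Aacc 0 0ℤ

Aacc-affine : ∀ ls p σ → Aacc p σ ls ≡ + (2 ^ p) ℤ.* A′ ls ℤ.+ σ ℤ.* (A 0 ls ℤ.- A′ ls)
Aacc-affine [] p σ = base (+ (2 ^ p)) σ
  where
  base : ∀ P σ → σ ≡ P ℤ.* 0ℤ ℤ.+ σ ℤ.* (1ℤ ℤ.- 0ℤ)
  base = ℤ-Ring.solve-∀
Aacc-affine (l ∷ ls) p σ = begin
  Aacc (p + l) (+ (2 ^ (p + l)) ℤ.- σ) ls
    ≡⟨ Aacc-affine ls (p + l) _ ⟩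
  + (2 ^ (p + l)) ℤ.* c ℤ.+ (+ (2 ^ (p + l)) ℤ.- σ) ℤ.* (b ℤ.- c)
    ≡⟨ cong (λ y → y ℤ.* c ℤ.+ (y ℤ.- σ) ℤ.* (b ℤ.- c)) 2^[p+l] ⟩
  P ℤ.* L ℤ.* c ℤ.+ (P ℤ.* L ℤ.- σ) ℤ.* (b ℤ.- c)
    ≡⟨ regroup P L σ b c ⟩
  P ℤ.* (L ℤ.* c ℤ.+ (L ℤ.- 0ℤ) ℤ.* (b ℤ.- c))
    ℤ.+ σ ℤ.* ((L ℤ.* c ℤ.+ (L ℤ.- 1ℤ) ℤ.* (b ℤ.- c)) ℤ.- (L ℤ.* c ℤ.+ (L ℤ.- 0ℤ) ℤ.* (b ℤ.- c)))
    ≡⟨ sym (cong₂ (λ y z → P ℤ.* y ℤ.+ σ ℤ.* (z ℤ.- y)) (Aacc-affine ls l _) (Aacc-affine ls l _)) ⟩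
  P ℤ.* A′ (l ∷ ls) ℤ.+ σ ℤ.* (A 0 (l ∷ ls) ℤ.- A′ (l ∷ ls))
    ∎
  where
  P = + (2 ^ p)
  L = + (2 ^ l)
  b = A 0 ls
  c = A′ ls
  regroup : ∀ P L σ b c →
    P ℤ.* L ℤ.* c ℤ.+ (P ℤ.* L ℤ.- σ) ℤ.* (b ℤ.- c) ≡
    P ℤ.* (L ℤ.* c ℤ.+ (L ℤ.- 0ℤ) ℤ.* (b ℤ.- c))
      ℤ.+ σ ℤ.* ((L ℤ.* c ℤ.+ (L ℤ.- 1ℤ) ℤ.* (b ℤ.- c)) ℤ.- (L ℤ.* c ℤ.+ (L ℤ.- 0ℤ) ℤ.* (b ℤ.- c)))
  regroup = ℤ-Ring.solve-∀
  2^[p+l] : + (2 ^ (p + l)) ≡ P ℤ.* L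
  2^[p+l] = trans (cong +_ (^-distribˡ-+-* 2 p l)) (pos-* (2 ^ p) (2 ^ l))

A-scale : ∀ l0 ls → A l0 ls ≡ + (2 ^ l0) ℤ.* A 0 ls
A-scale l0 ls = trans (Aacc-affine ls l0 _) (regroup (+ (2 ^ l0)) (A 0 ls) (A′ ls))
  where
  regroup : ∀ P b c → P ℤ.* c ℤ.+ P ℤ.* (b ℤ.- c) ≡ P ℤ.* b
  regroup = ℤ-Ring.solve-∀

A′-cons : ∀ l ls → A′ (l ∷ ls) ≡ + (2 ^ l) ℤ.* A 0 ls
A′-cons l ls = trans (Aacc-affine ls l _) (regroup (+ (2 ^ l)) (A 0 ls) (A′ ls))
  where
  regroup : ∀ L b c → L ℤ.* c ℤ.+ (L ℤ.- 0ℤ) ℤ.* (b ℤ.- c) ≡ L ℤ.* b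
  regroup = ℤ-Ring.solve-∀

A-cons : ∀ l ls → A 0 (l ∷ ls) ≡ + (2 ^ l) ℤ.* A 0 ls ℤ.- A 0 ls ℤ.+ A′ ls
A-cons l ls = trans (Aacc-affine ls l _) (regroup (+ (2 ^ l)) (A 0 ls) (A′ ls))
  where
  regroup : ∀ L b c → L ℤ.* c ℤ.+ (L ℤ.- 1ℤ) ℤ.* (b ℤ.- c) ≡ L ℤ.* b ℤ.- b ℤ.+ c
  regroup = ℤ-Ring.solve-∀

pos-rearrange : ∀ x y z w → x + y ≡ z + w → + x ≡ + z ℤ.- + y ℤ.+ + w
pos-rearrange x y z w eq = begin
  + x                           ≡⟨ add-sub (+ x) (+ y) ⟩
  (+ x ℤ.+ + y) ℤ.- + y         ≡⟨ cong (ℤ._- + y) (sym (pos-+ x y)) ⟩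
  + (x + y) ℤ.- + y             ≡⟨ cong (λ n → + n ℤ.- + y) eq ⟩
  + (z + w) ℤ.- + y             ≡⟨ cong (ℤ._- + y) (pos-+ z w) ⟩
  (+ z ℤ.+ + w) ℤ.- + y         ≡⟨ swap (+ z) (+ w) (+ y) ⟩
  + z ℤ.- + y ℤ.+ + w           ∎
  where
  add-sub : ∀ u v → u ≡ (u ℤ.+ v) ℤ.- v
  add-sub = ℤ-Ring.solve-∀
  swap : ∀ u v t → (u ℤ.+ v) ℤ.- t ≡ u ℤ.- t ℤ.+ v
  swap = ℤ-Ring.solve-∀

record SternPair (ls : List ℕ) : Set where
  field
    b c      : ℕ
    adjacent : Adjacent b c
    A≡b      : A 0 ls ≡ + b
    A′≡c     : A′ ls ≡ + c
    s-b      : s b ≡ K ls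
    s-c      : s c ≡ K⁻ ls

extend : ∀ l {ls} → SternPair ls → SternPair (l ∷ ls)
extend l {ls} P = record
  { b        = next l adjacent
  ; c        = 2 ^ l * b
  ; adjacent = next-adjacent l adjacent
  ; A≡b      = begin
      A 0 (l ∷ ls)                                  ≡⟨ A-cons l ls ⟩
      + (2 ^ l) ℤ.* A 0 ls ℤ.- A 0 ls ℤ.+ A′ ls     ≡⟨ cong₂ (λ y z → + (2 ^ l) ℤ.* y ℤ.- y ℤ.+ z) A≡b A′≡c ⟩
      + (2 ^ l) ℤ.* + b ℤ.- + b ℤ.+ + c             ≡⟨ cong (λ y → y ℤ.- + b ℤ.+ + c) (sym (pos-* (2 ^ l) b)) ⟩
      + (2 ^ l * b) ℤ.- + b ℤ.+ + c                 ≡⟨ sym (pos-rearrange _ b _ c (next-+ l adjacent)) ⟩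
      + next l adjacent                             ∎
  ; A′≡c     = trans (A′-cons l ls) (trans (cong (+ (2 ^ l) ℤ.*_) A≡b) (sym (pos-* (2 ^ l) b)))
  ; s-b      = begin
      s (next l adjacent) ≡⟨ s-next l adjacent ⟩
      l * s b + s c       ≡⟨ cong₂ (λ y z → l * y + z) s-b s-c ⟩
      l * K ls + K⁻ ls    ≡⟨ sym (K-cons l ls) ⟩
      K (l ∷ ls)          ∎
  ; s-c      = trans (s-2^* l b) s-b
  }
  where open SternPair P

sternPair : ∀ ls → SternPair ls
sternPair [] = record
  { b = 1 ; c = 0 ; adjacent = down 0
  ; A≡b = refl ; A′≡c = refl ; s-b = refl ; s-c = refl }
sternPair (l ∷ ls) = extend l (sternPair ls)

A≡2^l0*b : ∀ l0 ls → A l0 ls ≡ + (2 ^ l0 * SternPair.b (sternPair ls))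
A≡2^l0*b l0 ls = begin
  A l0 ls                  ≡⟨ A-scale l0 ls ⟩
  + (2 ^ l0) ℤ.* A 0 ls    ≡⟨ cong (+ (2 ^ l0) ℤ.*_) A≡b ⟩
  + (2 ^ l0) ℤ.* + b       ≡⟨ sym (pos-* (2 ^ l0) b) ⟩
  + (2 ^ l0 * b)           ∎
  where open SternPair (sternPair ls)

proposition3p1 : (l0 : ℕ) (ls : List ℕ) → All (1 ≤_) ls →
    (A l0 ls ≡ + ∣ A l0 ls ∣) × (s ∣ A l0 ls ∣ ≡ K ls)
proposition3p1 l0 ls _ rewrite A≡2^l0*b l0 ls =
  refl , trans (s-2^* l0 (SternPair.b (sternPair ls))) (SternPair.s-b (sternPair ls))
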